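{- Let $n$ be a positive integer and let $D_n$ be a maximal Diophantine graph of order $n$. Then the number of full degree vertices of $D_n$ is $$F(D_n)=\tau(n)+\pi(n-1)-\pi\left(\tfrac{n}{2}\right)+\gamma_{\frac{n}{2}}(n).$$ In particular, if $n$ is prime, then $F(D_n)=\pi(n)-\pi\left(\tfrac{n}{2}\right)+1$.
   Context: All graphs are finite, simple and undirected. A graph $G$ with $n$ vertices is Diophantine if there is a bijection $f:V(G)\to\{1,\dots,n\}$ such that $\gcd(f(u),f(v))\mid n$ for every edge $uv$. A maximal Diophantine graph $D_n$ of order $n$ is a Diophantine graph of order $n$ such that adding any new edge yields a non-Diophantine graph. $F(G)$ is the number of vertices of degree $|V(G)|-1$. For real $x>0$, $\pi(x)$ is the number of primes $p\le x$; $\tau(n)$ is the number of positive divisors of $n$. For a prime $p$, $\acute{v}_p(n):=v_p(n)+1$ where $v_p$ is the $p$-adic valuation. For a real $0<x<n$, $\gamma_x(n):=\left|\{p^{\acute{v}_p(n)}: p \text{ prime},\ p\mid n,\ x<p^{\acute{v}_p(n)}<n\}\right|$. -}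

module Defs where

open import Data.Bool using (Bool; true; false; if_then_else_; _∨_; _∧_)
open import Data.Nat using (ℕ; zero; suc; _+_; _*_; _∸_; _^_; _<_; _≤_; _/_; _<?_; _≟_)
open import Data.Nat.Divisibility using (_∣_; _∣?_)
open import Data.Nat.GCD using (gcd)
open import Data.Nat.Primality using (Prime; prime?)
open import Data.Fin using (Fin; toℕ; _≟_)
open import Data.List using (List; length; filter; upTo; allFin; map)
open import Data.Nat.ListAction using (sum)
open import Data.Product using (Σ; _×_; _,_)
open import Function.Bundles using (_⤖_; Bijection)
open import Relation.Binary.PropositionalEquality using (_≡_; _≢_)
open import Relation.Nullary using (¬_; does)
open import Relation.Nullary.Decidable using (_×-dec_)

record Graph (n : ℕ) : Set where
  field
    adj    : Fin n → Fin n → Bool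
    sym    : ∀ u v → adj u v ≡ adj v u
    irrefl : ∀ v → adj v v ≡ false
open Graph public

label : {n : ℕ} → (Fin n ⤖ Fin n) → Fin n → ℕ
label f u = suc (toℕ (Bijection.to f u))

DiophantineRel : (n : ℕ) → (Fin n → Fin n → Bool) → Set
DiophantineRel n a =
  Σ (Fin n ⤖ Fin n) λ f →
    ∀ u v → a u v ≡ true → gcd (label f u) (label f v) ∣ n

Diophantine : {n : ℕ} → Graph n → Set
Diophantine {n} G = DiophantineRel n (adj G)

addEdge : {n : ℕ} → Graph n → Fin n → Fin n → (Fin n → Fin n → Bool)
addEdge G u v x y =
  adj G x y ∨ ((does (x Data.Fin.≟ u) ∧ does (y Data.Fin.≟ v))
             ∨ (does (x Data.Fin.≟ v) ∧ does (y Data.Fin.≟ u)))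

MaximalDiophantine : {n : ℕ} → Graph n → Set
MaximalDiophantine {n} G =
  Diophantine G ×
  (∀ u v → u ≢ v → adj G u v ≡ false → ¬ DiophantineRel n (addEdge G u v))

degree : {n : ℕ} → Graph n → Fin n → ℕ
degree {n} G v = sum (map (λ u → if adj G v u then 1 else 0) (allFin n))

F : {n : ℕ} → Graph n → ℕ
F {n} G = length (filter (λ v → degree G v Data.Nat.≟ (n ∸ 1)) (allFin n))

-- π(m): number of primes p ≤ m  (for real x, π(x) = π(⌊x⌋))
π : ℕ → ℕ
π m = length (filter prime? (upTo (suc m)))

τ : ℕ → ℕ
τ n = length (filter (λ d → d ∣? n) (map suc (upTo n)))

-- p-adic valuation v_p(m) (for p ≥ 2, m ≥ 1), computed with fuel.
valFuel : ℕ → ℕ → ℕ → ℕ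
valFuel zero    p m = 0
valFuel (suc k) p m with p Data.Nat.≟ 0 | p Data.Nat.≟ 1 | m Data.Nat.≟ 0 | p ∣? m
... | Relation.Nullary.yes _ | _ | _ | _ = 0
... | Relation.Nullary.no _ | Relation.Nullary.yes _ | _ | _ = 0
... | Relation.Nullary.no _ | Relation.Nullary.no _ | Relation.Nullary.yes _ | _ = 0
... | Relation.Nullary.no _ | Relation.Nullary.no _ | Relation.Nullary.no _ | Relation.Nullary.no _ = 0
... | Relation.Nullary.no p≢0 | Relation.Nullary.no _ | Relation.Nullary.no _ | Relation.Nullary.yes _ =
  suc (valFuel k p (Data.Nat._/_ m p {{Data.Nat.≢-nonZero p≢0}}))

v : ℕ → ℕ → ℕ
v p m = valFuel m p m

v́ : ℕ → ℕ → ℕ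
v́ p m = v p m + 1

-- γ_{n/2}(n) = |{ p^{v́_p(n)} : p prime, p ∣ n, n/2 < p^{v́_p(n)} < n }|.
-- Distinct primes give distinct prime powers, so this set is in bijection
-- with the primes p ≤ n satisfying the condition; n/2 < q is written n < 2q.
γHalf : ℕ → ℕ
γHalf n = length (filter (λ p → prime? p ×-dec (p ∣? n)
                                 ×-dec (n <? 2 * p ^ v́ p n)
                                 ×-dec (p ^ v́ p n <? n))
                         (upTo (suc n)))

{-# OPTIONS --safe #-}
module Submission where

-- In a maximal Diophantine graph labelled by f, distinct vertices u and v are adjacent exactly
-- when gcd (f u) (f v) ∣ n, for otherwise the edge uv could be added without breaking f. So v
-- has full degree iff its label k satisfies gcd k j ∣ n for all labels j ≠ k. If moreover k ∤ n,
-- then n < 2k (take j = 2k) and every proper divisor d of k divides n (take j = d); two coprime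
-- proper divisors would give k ∣ n, so k = p^(a+1) with p^a ∣ n and p^(a+1) ∤ n, i.e.
-- k = p^v́ₚ(n). Conversely, gcd k j ∣ k ∣ n if k ∣ n; and if n < 2k and all proper divisors
-- of k divide n, then for j ≤ n, j ≠ k, gcd k j is such a proper divisor. The full labels are
-- therefore the divisors of n, the primes in (n/2, n) (the case v́ₚ(n) = 1) and the powers
-- p^v́ₚ(n) in (n/2, n) with p ∣ n; these three disjoint families have τ(n), π(n-1) - π(n/2)
-- and γ_{n/2}(n) members.

open import Data.Bool using (Bool; true; false; if_then_else_; T; _∧_)
import Data.Bool as Bool
open import Data.Bool.Properties using (T-≡; T-∨; not-¬)
open import Data.Fin using (Fin; toℕ; fromℕ<)
import Data.Fin as Fin
open import Data.Fin.Properties using (toℕ<n; toℕ-injective; toℕ-fromℕ<)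
open import Data.List using (List; []; _∷_; length; map; filter; _++_; upTo; allFin)
open import Data.List.Membership.Propositional using (_∈_)
open import Data.List.Membership.Propositional.Properties
  using (∈-allFin; ∈-map⁺; ∈-map⁻; ∈-filter⁺; ∈-filter⁻; ∈-upTo⁺; ∈-upTo⁻;
         ∈-++⁺ˡ; ∈-++⁺ʳ; ∈-++⁻; ++-∈⇔)
open import Data.List.Membership.Propositional.Properties.WithK using (unique∧set⇒bag)
open import Data.List.Properties
  using (length-map; length-++; length-tabulate; filter-none; filter-all; filter-complete)
open import Data.List.Relation.Binary.BagAndSetEquality using (_∼[_]_; set; ∼bag⇒↭)
open import Data.List.Relation.Binary.Disjoint.Propositional using (Disjoint)
open import Data.List.Relation.Binary.Permutation.Propositional.Properties using (↭-length)
open import Data.List.Relation.Unary.All as All using (All; []; _∷_)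
import Data.List.Relation.Unary.All.Properties as All
open import Data.List.Relation.Unary.AllPairs using ([]; _∷_)
open import Data.List.Relation.Unary.Any using (here; there)
open import Data.List.Relation.Unary.Unique.Propositional using (Unique)
import Data.List.Relation.Unary.Unique.Propositional.Properties as Unique
open import Data.Nat.Base
  using (ℕ; zero; suc; pred; _+_; _*_; _∸_; _^_; _/_; _≤_; _<_; z≤n; s≤s; z<s;
         nonTrivial⇒n>1; ≢-nonZero⁻¹; >-nonZero)
open import Data.Nat.Coprimality using (Coprime; coprime-divisor; coprime⇒gcd≡1)
open import Data.Nat.Divisibility
open import Data.Nat.DivMod using (m/n<m; m≥n⇒m/n>0; m/n*n≤m; m*n/n≡m; /-monoˡ-≤)
open import Data.Nat.GCD using (gcd; gcd[m,n]∣m; gcd[m,n]∣n; gcd-greatest; gcd-comm)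
open import Data.Nat.LCM using (lcm; lcm-least; gcd*lcm)
open import Data.Nat.ListAction using (sum; product)
open import Data.Nat.Primality
  using (Prime; prime; prime?; prime⇒irreducible; prime⇒nonZero; euclidsLemma)
open import Data.Nat.Primality.Factorisation using (factorise)
open import Data.Nat.Properties
open import Data.Nat.Tactic.RingSolver using (solve-∀)
open import Data.Product using (∃; ∃₂; _×_; _,_; proj₁; proj₂)
open import Data.Sum using (_⊎_; inj₁; inj₂)
import Data.Sum as Sum
open import Data.Sum.Function.Propositional using (_⊎-⇔_)
open import Defs hiding (sym)
open import Function using (_∘_; flip; id; _⇔_; mk⇔; Equivalence)
open import Function.Bundles using (_⤖_; Bijection)
open import Function.Properties.Equivalence using () renaming (trans to ⇔-trans)
open import Level using (0ℓ)
open import Relation.Binary.Definitions using (tri<; tri≈; tri>)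
open import Relation.Binary.PropositionalEquality
  using (_≡_; _≢_; refl; sym; trans; cong; cong₂; subst; subst₂; module ≡-Reasoning)
open import Relation.Nullary using (¬_; Dec; yes; no; does; contradiction)
open import Relation.Nullary.Decidable using (_×-dec_; _⊎-dec_)
open import Relation.Unary using (Pred)

private
  variable
    a b d k m n o p q : ℕ

unique∧set⇒length≡ : {A : Set} {xs ys : List A} → Unique xs → Unique ys → xs ∼[ set ] ys →
                     length xs ≡ length ys
unique∧set⇒length≡ xs! ys! xs∼ys = ↭-length (∼bag⇒↭ (unique∧set⇒bag xs! ys! xs∼ys))

map-injectiveOn⁺ : {A B : Set} {P : Pred A 0ℓ} {f : A → B} {xs : List A} →
                   (∀ {x y} → P x → P y → f x ≡ f y → x ≡ y) →
                   All P xs → Unique xs → Unique (map f xs)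
map-injectiveOn⁺ inj []         []          = []
map-injectiveOn⁺ inj (px ∷ pxs) (x∉ ∷ xs!) =
  All.map⁺ (All.zipWith (λ (x≢y , py) → x≢y ∘ inj px py) (x∉ , pxs))
  ∷ map-injectiveOn⁺ inj pxs xs!

sum-map-indicator : {A : Set} (b : A → Bool) (xs : List A) →
  sum (map (λ x → if b x then 1 else 0) xs) ≡ length (filter (λ x → b x Bool.≟ true) xs)
sum-map-indicator b [] = refl
sum-map-indicator b (x ∷ xs) with b x
... | true  = cong suc (sum-map-indicator b xs)
... | false = sum-map-indicator b xs

prime>1 : Prime p → 1 < p
prime>1 {p} (prime _) = nonTrivial⇒n>1 p

∣⇒≥1 : 1 ≤ n → k ∣ n → 1 ≤ k
∣⇒≥1 1≤n k∣n = n≢0⇒n>0 λ { refl → >⇒≢ 1≤n (0∣⇒≡0 k∣n) }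

∣∧<2*⇒≡ : k ∣ m → 1 ≤ m → m < 2 * k → m ≡ k
∣∧<2*⇒≡ (divides 1 refl) _ _ = +-identityʳ _
∣∧<2*⇒≡ {k} (divides (suc (suc q)) refl) _ m<2k =
  contradiction m<2k (≤⇒≯ (+-monoʳ-≤ k (+-monoʳ-≤ k z≤n)))

≤/2⇔2*≤ : k ≤ n / 2 ⇔ 2 * k ≤ n
≤/2⇔2*≤ {k} {n} = mk⇔ ⇒ ⇐
  where
  ⇒ : k ≤ n / 2 → 2 * k ≤ n
  ⇒ k≤n/2 = ≤-trans (≤-reflexive (*-comm 2 k)) (≤-trans (*-monoˡ-≤ 2 k≤n/2) (m/n*n≤m n 2))
  ⇐ : 2 * k ≤ n → k ≤ n / 2
  ⇐ 2k≤n = subst (_≤ n / 2) (m*n/n≡m k 2) (/-monoˡ-≤ 2 (subst (_≤ n) (*-comm 2 k) 2k≤n))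

∣-^-monoʳ : ∀ p → a ≤ b → p ^ a ∣ p ^ b
∣-^-monoʳ {a} {b} p a≤b = divides (p ^ (b ∸ a)) (begin
  p ^ b                ≡⟨ cong (p ^_) (m+[n∸m]≡n a≤b) ⟨
  p ^ (a + (b ∸ a))    ≡⟨ ^-distribˡ-+-* p a (b ∸ a) ⟩
  p ^ a * p ^ (b ∸ a)  ≡⟨ *-comm (p ^ a) _ ⟩
  p ^ (b ∸ a) * p ^ a  ∎)
  where open ≡-Reasoning

m∣n⇒gcd[m,n]≡m : m ∣ n → gcd m n ≡ m
m∣n⇒gcd[m,n]≡m {m} {n} m∣n = ∣-antisym (gcd[m,n]∣m m n) (gcd-greatest ∣-refl m∣n)

prime∤⇒coprime : Prime p → ¬ p ∣ m → Coprime p m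
prime∤⇒coprime pp p∤m (d∣p , d∣m) with prime⇒irreducible pp d∣p
... | inj₁ d≡1  = d≡1
... | inj₂ refl = contradiction d∣m p∤m

coprime-*ˡ : Coprime a n → Coprime b n → Coprime (a * b) n
coprime-*ˡ {a} a⊥n b⊥n {d} (d∣ab , d∣n) = b⊥n (coprime-divisor d⊥a d∣ab , d∣n)
  where
  d⊥a : Coprime d a
  d⊥a (e∣d , e∣a) = a⊥n (e∣a , ∣-trans e∣d d∣n)

coprime-^ˡ : ∀ k → Coprime m n → Coprime (m ^ k) n
coprime-^ˡ zero    _   (d∣1 , _) = ∣1⇒≡1 d∣1
coprime-^ˡ (suc k) m⊥n = coprime-*ˡ m⊥n (coprime-^ˡ k m⊥n)

coprime∧∣∧∣⇒*∣ : Coprime m n → m ∣ o → n ∣ o → m * n ∣ o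
coprime∧∣∧∣⇒*∣ {m} {n} m⊥n m∣o n∣o = subst (_∣ _) lcm≡m*n (lcm-least m∣o n∣o)
  where
  open ≡-Reasoning
  lcm≡m*n : lcm m n ≡ m * n
  lcm≡m*n = begin
    lcm m n            ≡⟨ *-identityˡ (lcm m n) ⟨
    1 * lcm m n        ≡⟨ cong (_* lcm m n) (coprime⇒gcd≡1 m⊥n) ⟨
    gcd m n * lcm m n  ≡⟨ gcd*lcm m n ⟩
    m * n              ∎

∃prime∣ : 1 < k → ∃ λ p → Prime p × p ∣ k
∃prime∣ {suc k} 1<1+k with factorise (suc k)
... | record { factors = [] ; isFactorisation = 1+k≡1 } =
  contradiction (suc-injective 1+k≡1) (>⇒≢ (≤-pred 1<1+k))
... | record { factors = p ∷ ps ; isFactorisation = 1+k≡p*ps ; factorsPrime = pp ∷ _ } =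
  p , pp , divides (product ps) (trans 1+k≡p*ps (*-comm p (product ps)))

module _ (pp : Prime p) where

  private instance
    p≢0 = prime⇒nonZero pp

  valFuel-spec : ∀ f → 1 ≤ m → m ≤ f →
                 p ^ valFuel f p m ∣ m × ¬ p ^ suc (valFuel f p m) ∣ m
  valFuel-spec zero 1≤m m≤0 = contradiction (≤-trans 1≤m m≤0) λ ()
  valFuel-spec {m} (suc f) 1≤m m≤1+f with p ≟ 0 | p ≟ 1 | m ≟ 0 | p ∣? m
  ... | yes p≡0 | _       | _       | _      = contradiction p≡0 (≢-nonZero⁻¹ p)
  ... | no _    | yes p≡1 | _       | _      = contradiction p≡1 (>⇒≢ (prime>1 pp))
  ... | no _    | no _    | yes m≡0 | _      = contradiction m≡0 (>⇒≢ 1≤m)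
  ... | no _    | no _    | no _    | no p∤m = 1∣ m , p∤m ∘ subst (_∣ m) (*-identityʳ p)
  ... | no _    | no _    | no _    | yes p∣m =
    m∣n/o⇒o*m∣n p∣m (proj₁ m/p-spec) , proj₂ m/p-spec ∘ m*n∣o⇒n∣o/m p _
    where
    instance _ = >-nonZero 1≤m
    m/p-spec = valFuel-spec f (m≥n⇒m/n>0 (∣⇒≤ p∣m))
                              (<⇒≤pred (<-≤-trans (m/n<m m p (prime>1 pp)) m≤1+f))

  p^v∣ : 1 ≤ m → p ^ v p m ∣ m
  p^v∣ {m} 1≤m = proj₁ (valFuel-spec m 1≤m ≤-refl)

  p^[1+v]∤ : 1 ≤ m → ¬ p ^ suc (v p m) ∣ m
  p^[1+v]∤ {m} 1≤m = proj₂ (valFuel-spec m 1≤m ≤-refl)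

  v≡ : 1 ≤ m → p ^ a ∣ m → ¬ p ^ suc a ∣ m → v p m ≡ a
  v≡ {m} {a} 1≤m p^a∣m p^[1+a]∤m with <-cmp (v p m) a
  ... | tri< v<a _ _ = contradiction (∣-trans (∣-^-monoʳ p v<a) p^a∣m) (p^[1+v]∤ 1≤m)
  ... | tri≈ _ v≡a _ = v≡a
  ... | tri> _ _ a<v = contradiction (∣-trans (∣-^-monoʳ p a<v) (p^v∣ 1≤m)) p^[1+a]∤m

  p^v́≡p^[1+v] : ∀ m → p ^ v́ p m ≡ p ^ suc (v p m)
  p^v́≡p^[1+v] m = cong (p ^_) (+-comm (v p m) 1)

  p^v́∤ : 1 ≤ m → ¬ p ^ v́ p m ∣ m
  p^v́∤ {m} 1≤m = p^[1+v]∤ 1≤m ∘ subst (_∣ m) (p^v́≡p^[1+v] m)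

  p∣p^v́ : ∀ m → p ∣ p ^ v́ p m
  p∣p^v́ m = subst (p ∣_) (sym (p^v́≡p^[1+v] m)) (m∣m*n (p ^ v p m))

  p-power-decomposition : 1 ≤ m → ∃₂ λ a q → m ≡ p ^ a * q × ¬ p ∣ q
  p-power-decomposition {m} 1≤m = v p m , quotient p^v∣m , m∣n⇒n≡m*quotient p^v∣m , p∤q
    where
    p^v∣m = p^v∣ 1≤m
    p∤q : ¬ p ∣ quotient p^v∣m
    p∤q p∣q = p^[1+v]∤ 1≤m (subst₂ _∣_ (*-comm (p ^ v p m) p)
                                      (sym (m∣n⇒n≡m*quotient p^v∣m))
                                      (*-monoʳ-∣ (p ^ v p m) p∣q))

  ∣^⇒∣ : ∀ k → p ∣ m ^ k → p ∣ m
  ∣^⇒∣ zero    p∣1 = contradiction (∣1⇒≡1 p∣1) (>⇒≢ (prime>1 pp))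
  ∣^⇒∣ {m} (suc k) p∣m*m^k with euclidsLemma m (m ^ k) pp p∣m*m^k
  ... | inj₁ p∣m   = p∣m
  ... | inj₂ p∣m^k = ∣^⇒∣ k p∣m^k

  ∣p^[1+a]∧≢⇒∣p^a : d ∣ p ^ suc a → d ≢ p ^ suc a → d ∣ p ^ a
  ∣p^[1+a]∧≢⇒∣p^a {d} {a} (divides q p^[1+a]≡q*d) d≢p^[1+a] with p ∣? q
  ... | yes (divides r q≡r*p) = divides r (*-cancelˡ-≡ (p ^ a) (r * d) p (begin
    p * p ^ a    ≡⟨ p^[1+a]≡q*d ⟩
    q * d        ≡⟨ cong (_* d) q≡r*p ⟩
    r * p * d    ≡⟨ cong (_* d) (*-comm r p) ⟩
    p * r * d    ≡⟨ *-assoc p r d ⟩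
    p * (r * d)  ∎))
    where open ≡-Reasoning
  ... | no p∤q = contradiction (begin
    d          ≡⟨ *-identityˡ d ⟨
    1 * d      ≡⟨ cong (_* d) q≡1 ⟨
    q * d      ≡⟨ p^[1+a]≡q*d ⟨
    p ^ suc a  ∎) d≢p^[1+a]
    where
    open ≡-Reasoning
    q≡1 : q ≡ 1
    q≡1 = coprime-^ˡ (suc a) (prime∤⇒coprime pp p∤q)
            (divides d (trans p^[1+a]≡q*d (*-comm q d)) , ∣-refl)

ProperDivisorsDivide : ℕ → ℕ → Set
ProperDivisorsDivide k n = ∀ {d} → d ∣ k → d ≢ k → d ∣ n

properDivisorsDivide⇒primePower : 1 ≤ k → ¬ k ∣ n → ProperDivisorsDivide k n →
                                  ∃₂ λ p a → Prime p × k ≡ p ^ suc a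
properDivisorsDivide⇒primePower {k} {n} 1≤k k∤n proper
  with p , pp , p∣k ← ∃prime∣ (≤∧≢⇒< 1≤k λ { refl → k∤n (1∣ n) })
  with p-power-decomposition pp 1≤k
... | zero , q , k≡1*q , p∤q = contradiction (subst (p ∣_) (trans k≡1*q (*-identityˡ q)) p∣k) p∤q
... | suc a , 0 , k≡P*0 , _  = contradiction (trans k≡P*0 (*-zeroʳ (p ^ suc a))) (>⇒≢ 1≤k)
... | suc a , 1 , k≡P*1 , _  = p , a , pp , trans k≡P*1 (*-identityʳ (p ^ suc a))
... | suc a , q@(suc (suc _)) , k≡P*q , p∤q = contradiction (subst (_∣ n) (sym k≡P*q) P*q∣n) k∤n
  where
  P = p ^ suc a
  instance _ = m^n≢0 p (suc a) {{prime⇒nonZero pp}}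
  P<k : P < k
  P<k = subst (P <_) (sym k≡P*q) (m<m*n P q (s≤s (s≤s z≤n)))
  q<k : q < k
  q<k = subst (q <_) (trans (*-comm q P) (sym k≡P*q))
              (m<m*n q P (^-monoʳ-< p (prime>1 pp) {0} {suc a} z<s))
  P*q∣n : P * q ∣ n
  P*q∣n = coprime∧∣∧∣⇒*∣ (coprime-^ˡ (suc a) (prime∤⇒coprime pp p∤q))
            (proper (divides q (trans k≡P*q (*-comm P q))) (<⇒≢ P<k))
            (proper (divides P k≡P*q) (<⇒≢ q<k))

FullLabel : ℕ → ℕ → Set
FullLabel n k = ∀ j → 1 ≤ j → j ≤ n → j ≢ k → gcd k j ∣ n

LargePrime : ℕ → ℕ → Set
LargePrime n k = Prime k × n < 2 * k × k < n

γPrime : ℕ → ℕ → Set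
γPrime n p = Prime p × p ∣ n × n < 2 * p ^ v́ p n × p ^ v́ p n < n

γPower : ℕ → ℕ → Set
γPower n k = ∃ λ p → γPrime n p × k ≡ p ^ v́ p n

FullLabelForm : ℕ → ℕ → Set
FullLabelForm n k = k ∣ n ⊎ LargePrime n k ⊎ γPower n k

fullLabel⇒properDivisorsDivide : 1 ≤ k → k ≤ n → FullLabel n k → ProperDivisorsDivide k n
fullLabel⇒properDivisorsDivide {k} {n} 1≤k k≤n full {d} d∣k d≢k =
  subst (_∣ n) gcd[k,d]≡d
    (full d (∣⇒≥1 1≤k d∣k) (≤-trans (∣⇒≤ {{>-nonZero 1≤k}} d∣k) k≤n) d≢k)
  where
  gcd[k,d]≡d = trans (gcd-comm k d) (m∣n⇒gcd[m,n]≡m d∣k)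

fullLabel∧∤⇒n<2*k : 1 ≤ k → FullLabel n k → ¬ k ∣ n → n < 2 * k
fullLabel∧∤⇒n<2*k {k} {n} 1≤k full k∤n with n <? 2 * k
... | yes n<2k = n<2k
... | no  n≮2k =
  contradiction (subst (_∣ n) gcd[k,2k]≡k (full (2 * k) 1≤2k (≮⇒≥ n≮2k) (>⇒≢ k<2k))) k∤n
  where
  gcd[k,2k]≡k = m∣n⇒gcd[m,n]≡m (n∣m*n 2)
  k<2k : k < 2 * k
  k<2k = subst (k <_) (*-comm k 2) (m<m*n k 2 {{>-nonZero 1≤k}} (s≤s (s≤s z≤n)))
  1≤2k = ≤-trans 1≤k (<⇒≤ k<2k)

aboveHalf∧properDivisorsDivide⇒fullLabel : n < 2 * k → ProperDivisorsDivide k n → FullLabel n k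
aboveHalf∧properDivisorsDivide⇒fullLabel {n} {k} n<2k proper j 1≤j j≤n j≢k =
  proper (gcd[m,n]∣m k j) λ gcd≡k →
    j≢k (∣∧<2*⇒≡ (subst (_∣ j) gcd≡k (gcd[m,n]∣n k j)) 1≤j (≤-<-trans j≤n n<2k))

primePower⇒largePrime⊎γPower : Prime p → 1 ≤ n → ProperDivisorsDivide (p ^ suc a) n →
  ¬ p ^ suc a ∣ n → n < 2 * p ^ suc a → p ^ suc a < n →
  LargePrime n (p ^ suc a) ⊎ γPower n (p ^ suc a)
primePower⇒largePrime⊎γPower {p} {n} {zero} pp _ _ _ n<2p p<n =
  inj₁ (subst Prime (sym (*-identityʳ p)) pp , n<2p , p<n)
primePower⇒largePrime⊎γPower {p} {n} {a@(suc b)} pp 1≤n proper k∤n n<2k k<n =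
  inj₂ (p , (pp , p∣n , subst (λ k → n < 2 * k) k≡p^v́ n<2k , subst (_< n) k≡p^v́ k<n)
       , k≡p^v́)
  where
  p^a∣n : p ^ a ∣ n
  p^a∣n = proper (∣n⇒∣m*n p ∣-refl) (<⇒≢ (^-monoʳ-< p (prime>1 pp) (n<1+n a)))
  p∣n : p ∣ n
  p∣n = ∣-trans (m∣m*n (p ^ b)) p^a∣n
  k≡p^v́ : p ^ suc a ≡ p ^ v́ p n
  k≡p^v́ = trans (cong (λ e → p ^ suc e) (sym (v≡ pp {a = a} 1≤n p^a∣n k∤n)))
                (sym (p^v́≡p^[1+v] pp n))

fullLabel⇒form : 1 ≤ n → 1 ≤ k → k ≤ n → FullLabel n k → FullLabelForm n k
fullLabel⇒form {n} {k} 1≤n 1≤k k≤n full with k ∣? n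
... | yes k∣n = inj₁ k∣n
... | no  k∤n
  with proper ← fullLabel⇒properDivisorsDivide 1≤k k≤n full
  with p , a , pp , refl ← properDivisorsDivide⇒primePower 1≤k k∤n proper =
  inj₂ (primePower⇒largePrime⊎γPower {a = a} pp 1≤n proper k∤n
          (fullLabel∧∤⇒n<2*k 1≤k full k∤n) (≤∧≢⇒< k≤n λ { refl → k∤n ∣-refl }))

form⇒fullLabel : 1 ≤ n → FullLabelForm n k → FullLabel n k
form⇒fullLabel {n} {k} _ (inj₁ k∣n) j _ _ _ = ∣-trans (gcd[m,n]∣m k j) k∣n
form⇒fullLabel {n} _ (inj₂ (inj₁ (pk , n<2k , _))) =
  aboveHalf∧properDivisorsDivide⇒fullLabel n<2k proper
  where
  proper : ProperDivisorsDivide _ n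
  proper d∣k d≢k with prime⇒irreducible pk d∣k
  ... | inj₁ refl = 1∣ n
  ... | inj₂ d≡k  = contradiction d≡k d≢k
form⇒fullLabel {n} 1≤n (inj₂ (inj₂ (p , (pp , _ , n<2k , _) , refl))) =
  aboveHalf∧properDivisorsDivide⇒fullLabel n<2k proper
  where
  proper : ProperDivisorsDivide (p ^ v́ p n) n
  proper d∣k d≢k = ∣-trans (∣p^[1+a]∧≢⇒∣p^a pp {a = v p n} (subst (_ ∣_) k≡p^[1+v] d∣k)
                                                          (d≢k ∘ flip trans (sym k≡p^[1+v])))
                           (p^v∣ pp 1≤n)
    where k≡p^[1+v] = p^v́≡p^[1+v] pp n

divisor⇒¬largePrime : 1 ≤ n → k ∣ n → ¬ LargePrime n k
divisor⇒¬largePrime 1≤n k∣n (_ , n<2k , k<n) = <⇒≢ k<n (sym (∣∧<2*⇒≡ k∣n 1≤n n<2k))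

γPower⇒∤ : 1 ≤ n → γPower n k → ¬ k ∣ n
γPower⇒∤ 1≤n (p , (pp , _) , refl) = p^v́∤ pp 1≤n

largePrime⇒¬γPower : 1 ≤ n → LargePrime n k → ¬ γPower n k
largePrime⇒¬γPower {n} 1≤n (pk , _) γk@(p , (pp , p∣n , _) , refl)
  with prime⇒irreducible pk (p∣p^v́ pp n)
... | inj₁ p≡1 = contradiction p≡1 (>⇒≢ (prime>1 pp))
... | inj₂ p≡k = γPower⇒∤ 1≤n γk (subst (_∣ n) p≡k p∣n)

labels : ℕ → List ℕ
labels n = map suc (upTo n)

∈labels⇔ : k ∈ labels n ⇔ (1 ≤ k × k ≤ n)
∈labels⇔ = mk⇔ ⇒ ⇐
  where
  ⇒ : k ∈ labels n → 1 ≤ k × k ≤ n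
  ⇒ k∈ with i , i∈ , refl ← ∈-map⁻ suc k∈ = s≤s z≤n , ∈-upTo⁻ i∈
  ⇐ : 1 ≤ k × k ≤ n → k ∈ labels n
  ⇐ (s≤s z≤n , k≤n) = ∈-map⁺ suc (∈-upTo⁺ k≤n)

divisors : ℕ → List ℕ
divisors n = filter (_∣? n) (labels n)

divisors-unique : Unique (divisors n)
divisors-unique {n} = Unique.filter⁺ (_∣? n) (Unique.map⁺ suc-injective (Unique.upTo⁺ n))

∈divisors⇔ : 1 ≤ n → k ∈ divisors n ⇔ k ∣ n
∈divisors⇔ {n} {k} 1≤n = mk⇔ (proj₂ ∘ ∈-filter⁻ (_∣? n) {xs = labels n}) ⇐
  where
  ⇐ : k ∣ n → k ∈ divisors n
  ⇐ k∣n = ∈-filter⁺ (_∣? n)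
    (Equivalence.from ∈labels⇔ (∣⇒≥1 1≤n k∣n , ∣⇒≤ {{>-nonZero 1≤n}} k∣n)) k∣n

largePrime? : ∀ n k → Dec (LargePrime n k)
largePrime? n k = prime? k ×-dec n <? 2 * k ×-dec k <? n

largePrimes : ℕ → List ℕ
largePrimes n = filter (largePrime? n) (upTo n)

largePrimes-unique : Unique (largePrimes n)
largePrimes-unique {n} = Unique.filter⁺ (largePrime? n) (Unique.upTo⁺ n)

∈largePrimes⇔ : k ∈ largePrimes n ⇔ LargePrime n k
∈largePrimes⇔ {k} {n} = mk⇔ (proj₂ ∘ ∈-filter⁻ (largePrime? n) {xs = upTo n}) ⇐
  where
  ⇐ : LargePrime n k → k ∈ largePrimes n
  ⇐ lp@(_ , _ , k<n) = ∈-filter⁺ (largePrime? n) (∈-upTo⁺ k<n) lp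

γPrime? : ∀ n p → Dec (γPrime n p)
γPrime? n p = prime? p ×-dec p ∣? n ×-dec n <? 2 * p ^ v́ p n ×-dec p ^ v́ p n <? n

γPowers : ℕ → List ℕ
γPowers n = map (λ p → p ^ v́ p n) (filter (γPrime? n) (upTo (suc n)))

length-γPowers : length (γPowers n) ≡ γHalf n
length-γPowers {n} = length-map (λ p → p ^ v́ p n) (filter (γPrime? n) (upTo (suc n)))

γPowers-unique : Unique (γPowers n)
γPowers-unique {n} = map-injectiveOn⁺ p^v́-injective
  (All.all-filter (γPrime? n) (upTo (suc n))) (Unique.filter⁺ (γPrime? n) (Unique.upTo⁺ (suc n)))
  where
  p^v́-injective : ∀ {p q} → γPrime n p → γPrime n q → p ^ v́ p n ≡ q ^ v́ q n → p ≡ q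
  p^v́-injective {p} {q} (pp , _) (pq , _) p^v́≡q^v́
    with prime⇒irreducible pq (∣^⇒∣ pp (v́ q n) (subst (p ∣_) p^v́≡q^v́ (p∣p^v́ pp n)))
  ... | inj₁ p≡1 = contradiction p≡1 (>⇒≢ (prime>1 pp))
  ... | inj₂ p≡q = p≡q

∈γPowers⇔ : 1 ≤ n → k ∈ γPowers n ⇔ γPower n k
∈γPowers⇔ {n} {k} 1≤n = mk⇔ ⇒ ⇐
  where
  ⇒ : k ∈ γPowers n → γPower n k
  ⇒ k∈ with p , p∈ , k≡p^v́ ← ∈-map⁻ _ k∈ =
    p , proj₂ (∈-filter⁻ (γPrime? n) {xs = upTo (suc n)} p∈) , k≡p^v́
  ⇐ : γPower n k → k ∈ γPowers n
  ⇐ (p , γp@(_ , p∣n , _) , refl) =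
    ∈-map⁺ _ (∈-filter⁺ (γPrime? n) (∈-upTo⁺ (s≤s (∣⇒≤ {{>-nonZero 1≤n}} p∣n))) γp)

fullLabels : ℕ → List ℕ
fullLabels n = divisors n ++ largePrimes n ++ γPowers n

length-fullLabels : length (fullLabels n) ≡ τ n + (length (largePrimes n) + γHalf n)
length-fullLabels {n} = begin
  length (divisors n ++ largePrimes n ++ γPowers n)
    ≡⟨ length-++ (divisors n) ⟩
  τ n + length (largePrimes n ++ γPowers n)
    ≡⟨ cong (τ n +_) (length-++ (largePrimes n)) ⟩
  τ n + (length (largePrimes n) + length (γPowers n))
    ≡⟨ cong (λ g → τ n + (length (largePrimes n) + g)) (length-γPowers {n}) ⟩
  τ n + (length (largePrimes n) + γHalf n)
    ∎
  where open ≡-Reasoning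

∈fullLabels⇔form : 1 ≤ n → k ∈ fullLabels n ⇔ FullLabelForm n k
∈fullLabels⇔form {n} 1≤n =
  ⇔-trans ++-∈⇔ (∈divisors⇔ 1≤n ⊎-⇔ ⇔-trans ++-∈⇔ (∈largePrimes⇔ ⊎-⇔ ∈γPowers⇔ 1≤n))

fullLabels-unique : 1 ≤ n → Unique (fullLabels n)
fullLabels-unique {n} 1≤n =
  Unique.++⁺ (divisors-unique {n})
             (Unique.++⁺ (largePrimes-unique {n}) (γPowers-unique {n}) largePrimes#γPowers)
             divisors#others
  where
  open Equivalence
  largePrimes#γPowers : Disjoint (largePrimes n) (γPowers n)
  largePrimes#γPowers (k∈₁ , k∈₂) =
    largePrime⇒¬γPower 1≤n (to ∈largePrimes⇔ k∈₁) (to (∈γPowers⇔ 1≤n) k∈₂)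
  divisors#others : Disjoint (divisors n) (largePrimes n ++ γPowers n)
  divisors#others (k∈₁ , k∈₂) with to (∈divisors⇔ 1≤n) k∈₁ | ∈-++⁻ (largePrimes n) k∈₂
  ... | k∣n | inj₁ k∈₂ = divisor⇒¬largePrime 1≤n k∣n (to ∈largePrimes⇔ k∈₂)
  ... | k∣n | inj₂ k∈₂ = γPower⇒∤ 1≤n (to (∈γPowers⇔ 1≤n) k∈₂) k∣n

∈fullLabels⇔fullLabel : 1 ≤ n → k ∈ fullLabels n ⇔ (k ∈ labels n × FullLabel n k)
∈fullLabels⇔fullLabel {n} {k} 1≤n = mk⇔ ⇒ ⇐
  where
  open Equivalence
  bounds : FullLabelForm n k → 1 ≤ k × k ≤ n
  bounds (inj₁ k∣n) = ∣⇒≥1 1≤n k∣n , ∣⇒≤ {{>-nonZero 1≤n}} k∣n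
  bounds (inj₂ (inj₁ (pk , _ , k<n))) = <⇒≤ (prime>1 pk) , <⇒≤ k<n
  bounds (inj₂ (inj₂ (p , (pp , _ , _ , k<n) , refl))) =
    m^n>0 p {{prime⇒nonZero pp}} (v́ p n) , <⇒≤ k<n
  ⇒ : k ∈ fullLabels n → k ∈ labels n × FullLabel n k
  ⇒ k∈ = let form = to (∈fullLabels⇔form 1≤n) k∈ in
    from ∈labels⇔ (bounds form) , form⇒fullLabel 1≤n form
  ⇐ : k ∈ labels n × FullLabel n k → k ∈ fullLabels n
  ⇐ (k∈ , full) = let 1≤k , k≤n = to ∈labels⇔ k∈ in
    from (∈fullLabels⇔form 1≤n) (fullLabel⇒form 1≤n 1≤k k≤n full)

primesBelow : ℕ → List ℕ
primesBelow n = filter prime? (upTo n)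

primesBelow-unique : Unique (primesBelow n)
primesBelow-unique {n} = Unique.filter⁺ prime? (Unique.upTo⁺ n)

length-largePrimes : 1 ≤ n → length (largePrimes n) + π (n / 2) ≡ π (n ∸ 1)
length-largePrimes {n@(suc n-1)} _ = begin
  length (largePrimes n) + π (n / 2)               ≡⟨ +-comm (length (largePrimes n)) _ ⟩
  π (n / 2) + length (largePrimes n)               ≡⟨ length-++ (primesBelow (suc (n / 2))) ⟨
  length (primesBelow (suc (n / 2)) ++ largePrimes n)
    ≡⟨ unique∧set⇒length≡ small++large-unique (primesBelow-unique {n}) small++large∼all ⟩
  π n-1                                            ∎
  where
  open ≡-Reasoning
  open Equivalence
  ∈large⇔ : ∀ {k} → k ∈ largePrimes n ⇔ LargePrime n k
  ∈large⇔ = ∈largePrimes⇔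
  small#large : Disjoint (primesBelow (suc (n / 2))) (largePrimes n)
  small#large (p∈₁ , p∈₂)
    with p∈upTo , _ ← ∈-filter⁻ prime? {xs = upTo (suc (n / 2))} p∈₁
    with _ , n<2p , _ ← to ∈large⇔ p∈₂ = <⇒≱ n<2p (to ≤/2⇔2*≤ (≤-pred (∈-upTo⁻ p∈upTo)))
  small++large-unique : Unique (primesBelow (suc (n / 2)) ++ largePrimes n)
  small++large-unique =
    Unique.++⁺ (primesBelow-unique {suc (n / 2)}) (largePrimes-unique {n}) small#large
  small++large∼all : primesBelow (suc (n / 2)) ++ largePrimes n ∼[ set ] primesBelow n
  small++large∼all {p} = mk⇔ ⇒ ⇐
    where
    ⇒ : p ∈ primesBelow (suc (n / 2)) ++ largePrimes n → p ∈ primesBelow n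
    ⇒ p∈ with ∈-++⁻ (primesBelow (suc (n / 2))) p∈
    ... | inj₁ p∈₁ with p∈upTo , pp ← ∈-filter⁻ prime? {xs = upTo (suc (n / 2))} p∈₁ =
      ∈-filter⁺ prime? (∈-upTo⁺ (≤-<-trans (≤-pred (∈-upTo⁻ p∈upTo)) (m/n<m n 2 (s≤s (s≤s z≤n)))))
                pp
    ... | inj₂ p∈₂ with pp , _ , p<n ← to ∈large⇔ p∈₂ =
      ∈-filter⁺ prime? (∈-upTo⁺ p<n) pp
    ⇐ : p ∈ primesBelow n → p ∈ primesBelow (suc (n / 2)) ++ largePrimes n
    ⇐ p∈ with p∈upTo , pp ← ∈-filter⁻ prime? {xs = upTo n} p∈ with p ≤? n / 2
    ... | yes p≤n/2 = ∈-++⁺ˡ (∈-filter⁺ prime? (∈-upTo⁺ (s≤s p≤n/2)) pp)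
    ... | no  p≰n/2 =
      ∈-++⁺ʳ _ (from ∈large⇔ (pp , ≰⇒> (p≰n/2 ∘ from ≤/2⇔2*≤) , ∈-upTo⁻ p∈upTo))

τ-prime : Prime p → τ p ≡ 2
τ-prime {p} pp = unique∧set⇒length≡ (divisors-unique {p}) ((1≢p ∷ []) ∷ [] ∷ []) divisors∼1p
  where
  open Equivalence
  1≤p = <⇒≤ (prime>1 pp)
  1≢p = <⇒≢ (prime>1 pp)
  divisors∼1p : divisors p ∼[ set ] 1 ∷ p ∷ []
  divisors∼1p {k} = mk⇔ ⇒ ⇐
    where
    ⇒ : k ∈ divisors p → k ∈ 1 ∷ p ∷ []
    ⇒ k∈ with prime⇒irreducible pp (to (∈divisors⇔ 1≤p) k∈)
    ... | inj₁ k≡1 = here k≡1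
    ... | inj₂ k≡p = there (here k≡p)
    ⇐ : k ∈ 1 ∷ p ∷ [] → k ∈ divisors p
    ⇐ (here refl)         = from (∈divisors⇔ 1≤p) (1∣ p)
    ⇐ (there (here refl)) = from (∈divisors⇔ 1≤p) ∣-refl

γHalf-prime : Prime p → γHalf p ≡ 0
γHalf-prime {p} pp =
  cong length (filter-none (γPrime? p) {xs = upTo (suc p)} (All.tabulate λ _ → ¬γPrime))
  where
  ¬γPrime : ¬ γPrime p q
  ¬γPrime {q} (pq , q∣p , _ , q^v́<p) with prime⇒irreducible pp q∣p
  ... | inj₁ q≡1 = contradiction q≡1 (>⇒≢ (prime>1 pq))
  ... | inj₂ refl = <⇒≱ q^v́<p (∣⇒≤ {{m^n≢0 q (v́ q q) {{prime⇒nonZero pq}}}} (p∣p^v́ pq q))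

π-prime : Prime p → π p ≡ suc (π (p ∸ 1))
π-prime {p@(suc _)} pp =
  unique∧set⇒length≡ (primesBelow-unique {suc p}) (p∉ ∷ primesBelow-unique {p}) primes≤p∼
  where
  p∉ : All (p ≢_) (primesBelow p)
  p∉ = All.tabulate λ q∈ → >⇒≢ (∈-upTo⁻ (proj₁ (∈-filter⁻ prime? {xs = upTo p} q∈)))
  primes≤p∼ : primesBelow (suc p) ∼[ set ] p ∷ primesBelow p
  primes≤p∼ {q} = mk⇔ ⇒ ⇐
    where
    ⇒ : q ∈ primesBelow (suc p) → q ∈ p ∷ primesBelow p
    ⇒ q∈ with q∈upTo , pq ← ∈-filter⁻ prime? {xs = upTo (suc p)} q∈
         with m≤n⇒m<n∨m≡n (≤-pred (∈-upTo⁻ q∈upTo))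
    ... | inj₁ q<p = there (∈-filter⁺ prime? (∈-upTo⁺ q<p) pq)
    ... | inj₂ q≡p = here q≡p
    ⇐ : q ∈ p ∷ primesBelow p → q ∈ primesBelow (suc p)
    ⇐ (here refl) = ∈-filter⁺ prime? (∈-upTo⁺ ≤-refl) pp
    ⇐ (there q∈) with q∈upTo , pq ← ∈-filter⁻ prime? {xs = upTo p} q∈ =
      ∈-filter⁺ prime? (∈-upTo⁺ (m<n⇒m<1+n (∈-upTo⁻ q∈upTo))) pq

module _ {n : ℕ} (G : Graph n) where

  Universal : Fin n → Set
  Universal v = ∀ u → u ≢ v → adj G v u ≡ true

  neighbours : Fin n → List (Fin n)
  neighbours v = filter (λ u → adj G v u Bool.≟ true) (allFin n)

  closedNeighbourhood : Fin n → List (Fin n)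
  closedNeighbourhood v = filter (λ u → u Fin.≟ v ⊎-dec adj G v u Bool.≟ true) (allFin n)

  length-closedNeighbourhood : ∀ v → length (closedNeighbourhood v) ≡ suc (degree G v)
  length-closedNeighbourhood v =
    trans (unique∧set⇒length≡ (Unique.filter⁺ _ (Unique.allFin⁺ n))
                              (v∉ ∷ Unique.filter⁺ _ (Unique.allFin⁺ n)) closed∼)
          (cong suc (sym (sum-map-indicator (adj G v) (allFin n))))
    where
    v∉ : All (v ≢_) (neighbours v)
    v∉ = All.tabulate λ u∈ →
      λ { refl → not-¬ (irrefl G v) (proj₂ (∈-filter⁻ _ {xs = allFin n} u∈)) }
    closed∼ : closedNeighbourhood v ∼[ set ] v ∷ neighbours v
    closed∼ {u} = mk⇔ ⇒ ⇐
      where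
      ⇒ : u ∈ closedNeighbourhood v → u ∈ v ∷ neighbours v
      ⇒ u∈ with ∈-filter⁻ _ {xs = allFin n} u∈
      ... | _ , inj₁ u≡v      = here u≡v
      ... | _ , inj₂ adj≡true = there (∈-filter⁺ _ (∈-allFin u) adj≡true)
      ⇐ : u ∈ v ∷ neighbours v → u ∈ closedNeighbourhood v
      ⇐ (here refl) = ∈-filter⁺ _ (∈-allFin v) (inj₁ refl)
      ⇐ (there u∈)  = ∈-filter⁺ _ (∈-allFin u) (inj₂ (proj₂ (∈-filter⁻ _ {xs = allFin n} u∈)))

  degree≡n∸1⇔universal : ∀ v → degree G v ≡ n ∸ 1 ⇔ Universal v
  degree≡n∸1⇔universal v = mk⇔ ⇒ ⇐
    where
    open ≡-Reasoning
    Q? = λ u → u Fin.≟ v ⊎-dec adj G v u Bool.≟ true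
    length-allFin : length (allFin n) ≡ n
    length-allFin = length-tabulate id
    ⇒ : degree G v ≡ n ∸ 1 → Universal v
    ⇒ deg≡n∸1 u u≢v
      with ∈-filter⁻ Q? {xs = allFin n} (subst (u ∈_) (sym closed≡all) (∈-allFin u))
      where
      closed≡all : closedNeighbourhood v ≡ allFin n
      closed≡all = filter-complete Q? (begin
        length (closedNeighbourhood v)  ≡⟨ length-closedNeighbourhood v ⟩
        suc (degree G v)                ≡⟨ cong suc deg≡n∸1 ⟩
        suc (n ∸ 1)                     ≡⟨ m+[n∸m]≡n (≤-trans (s≤s z≤n) (toℕ<n v)) ⟩
        n                               ≡⟨ length-allFin ⟨
        length (allFin n)               ∎)
    ... | _ , inj₁ u≡v      = contradiction u≡v u≢v
    ... | _ , inj₂ adj≡true = adj≡true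
    ⇐ : Universal v → degree G v ≡ n ∸ 1
    ⇐ universal = begin
      degree G v                             ≡⟨ cong pred (length-closedNeighbourhood v) ⟨
      pred (length (closedNeighbourhood v))  ≡⟨ cong (pred ∘ length) closed≡all ⟩
      pred (length (allFin n))               ≡⟨ cong pred length-allFin ⟩
      pred n                                 ≡⟨ pred[m∸n]≡m∸[1+n] n 0 ⟩
      n ∸ 1                                  ∎
      where
      Q : ∀ u → u ≡ v ⊎ adj G v u ≡ true
      Q u with u Fin.≟ v
      ... | yes u≡v = inj₁ u≡v
      ... | no  u≢v = inj₂ (universal u u≢v)
      closed≡all : closedNeighbourhood v ≡ allFin n
      closed≡all = filter-all Q? (All.tabulate λ {u} _ → Q u)

addEdge-true : ∀ {n} (G : Graph n) {u v x y} → addEdge G u v x y ≡ true →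
               adj G x y ≡ true ⊎ (x ≡ u × y ≡ v) ⊎ (x ≡ v × y ≡ u)
addEdge-true G {u} {v} {x} {y} e with Equivalence.to (T-∨ {adj G x y}) (Equivalence.from T-≡ e)
... | inj₁ xy∈G  = inj₁ (Equivalence.to T-≡ xy∈G)
... | inj₂ added = inj₂ (Sum.map (both (x Fin.≟ u) (y Fin.≟ v)) (both (x Fin.≟ v) (y Fin.≟ u))
                                 (Equivalence.to T-∨ added))
  where
  both : ∀ {A B : Set} (a? : Dec A) (b? : Dec B) → T (does a? ∧ does b?) → A × B
  both (yes a) (yes b) _ = a , b
  both (yes _) (no _)  ()
  both (no _)  _       ()

module _ {n : ℕ} (f : Fin n ⤖ Fin n) where

  label-injective : ∀ {u v} → label f u ≡ label f v → u ≡ v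
  label-injective = Bijection.injective f ∘ toℕ-injective ∘ suc-injective

  label∈labels : ∀ u → label f u ∈ labels n
  label∈labels u = Equivalence.from ∈labels⇔ (s≤s z≤n , toℕ<n (Bijection.to f u))

  ∈labels⇒label : k ∈ labels n → ∃ λ u → label f u ≡ k
  ∈labels⇒label k∈ with i , i∈ , refl ← ∈-map⁻ suc k∈
                   with u , f[u]≡i ← Bijection.surjective f (fromℕ< (∈-upTo⁻ i∈)) =
    u , cong suc (trans (cong toℕ (f[u]≡i refl)) (toℕ-fromℕ< (∈-upTo⁻ i∈)))

module _ {n : ℕ} (G : Graph n) (maximal : MaximalDiophantine G) where

  private
    f = proj₁ (proj₁ maximal)
    f-labels-G = proj₂ (proj₁ maximal)

  gcd∣⇒adj : ∀ {u v} → u ≢ v → gcd (label f u) (label f v) ∣ n → adj G u v ≡ true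
  gcd∣⇒adj {u} {v} u≢v gcd∣n with adj G u v in uv∉G
  ... | true  = refl
  ... | false = contradiction (f , f-labels-G+uv) (proj₂ maximal u v u≢v uv∉G)
    where
    f-labels-G+uv : ∀ x y → addEdge G u v x y ≡ true → gcd (label f x) (label f y) ∣ n
    f-labels-G+uv x y xy∈G+uv with addEdge-true G xy∈G+uv
    ... | inj₁ xy∈G                 = f-labels-G x y xy∈G
    ... | inj₂ (inj₁ (refl , refl)) = gcd∣n
    ... | inj₂ (inj₂ (refl , refl)) = subst (_∣ n) (gcd-comm (label f u) (label f v)) gcd∣n

  universal⇔fullLabel : ∀ v → Universal G v ⇔ FullLabel n (label f v)
  universal⇔fullLabel v = mk⇔ ⇒ ⇐
    where
    ⇒ : Universal G v → FullLabel n (label f v)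
    ⇒ universal j 1≤j j≤n j≢k
      with u , refl ← ∈labels⇒label f (Equivalence.from ∈labels⇔ (1≤j , j≤n)) =
      f-labels-G v u (universal u (j≢k ∘ cong (label f)))
    ⇐ : FullLabel n (label f v) → Universal G v
    ⇐ full u u≢v = gcd∣⇒adj (u≢v ∘ sym)
      (full (label f u) (s≤s z≤n) (proj₂ (Equivalence.to ∈labels⇔ (label∈labels f u)))
            (u≢v ∘ label-injective f))

  fullDegree⇔fullLabel : ∀ v → degree G v ≡ n ∸ 1 ⇔ FullLabel n (label f v)
  fullDegree⇔fullLabel v = ⇔-trans (degree≡n∸1⇔universal G v) (universal⇔fullLabel v)

  F≡length-fullLabels : 1 ≤ n → F G ≡ length (fullLabels n)
  F≡length-fullLabels 1≤n = trans (sym (length-map (label f) full))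
    (unique∧set⇒length≡ (Unique.map⁺ (label-injective f) (Unique.filter⁺ full? (Unique.allFin⁺ n)))
                        (fullLabels-unique 1≤n) labels∼)
    where
    open Equivalence
    full? = λ v → degree G v ≟ n ∸ 1
    full = filter full? (allFin n)
    labels∼ : map (label f) full ∼[ set ] fullLabels n
    labels∼ {k} = mk⇔ ⇒ ⇐
      where
      ⇒ : k ∈ map (label f) full → k ∈ fullLabels n
      ⇒ k∈ with u , u∈ , refl ← ∈-map⁻ (label f) k∈ =
        from (∈fullLabels⇔fullLabel 1≤n)
          (label∈labels f u , to (fullDegree⇔fullLabel u) (proj₂ (∈-filter⁻ full? {xs = allFin n} u∈)))
      ⇐ : k ∈ fullLabels n → k ∈ map (label f) full
      ⇐ k∈ with k∈labels , fullLabel ← to (∈fullLabels⇔fullLabel 1≤n) k∈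
           with u , refl ← ∈labels⇒label f k∈labels =
        ∈-map⁺ (label f) (∈-filter⁺ full? (∈-allFin u) (from (fullDegree⇔fullLabel u) fullLabel))

theorem3p2 : (n : ℕ) → 1 ≤ n → (D : Graph n) → MaximalDiophantine D →
    (F D + π (n / 2) ≡ τ n + π (n ∸ 1) + γHalf n)
    × (Prime n → F D + π (n / 2) ≡ π n + 1)
theorem3p2 n 1≤n D maximal = general , prime-case
  where
  open ≡-Reasoning
  +-rearrange : ∀ t l g h → t + (l + g) + h ≡ t + (l + h) + g
  +-rearrange = solve-∀
  general : F D + π (n / 2) ≡ τ n + π (n ∸ 1) + γHalf n
  general = begin
    F D + π (n / 2)
      ≡⟨ cong (_+ π (n / 2)) (F≡length-fullLabels D maximal 1≤n) ⟩
    length (fullLabels n) + π (n / 2)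
      ≡⟨ cong (_+ π (n / 2)) (length-fullLabels {n}) ⟩
    τ n + (length (largePrimes n) + γHalf n) + π (n / 2)
      ≡⟨ +-rearrange (τ n) _ (γHalf n) (π (n / 2)) ⟩
    τ n + (length (largePrimes n) + π (n / 2)) + γHalf n
      ≡⟨ cong (λ l → τ n + l + γHalf n) (length-largePrimes 1≤n) ⟩
    τ n + π (n ∸ 1) + γHalf n
      ∎
  prime-case : Prime n → F D + π (n / 2) ≡ π n + 1
  prime-case pn = begin
    F D + π (n / 2)
      ≡⟨ general ⟩
    τ n + π (n ∸ 1) + γHalf n
      ≡⟨ cong₂ (λ t g → t + π (n ∸ 1) + g) (τ-prime {n} pn) (γHalf-prime {n} pn) ⟩
    2 + π (n ∸ 1) + 0
      ≡⟨ +-identityʳ _ ⟩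
    suc (suc (π (n ∸ 1)))
      ≡⟨ cong suc (π-prime pn) ⟨
    suc (π n)
      ≡⟨ +-comm 1 (π n) ⟩
    π n + 1
      ∎
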